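{- For $n\ge2$, let $L_{3n}$ be the tree obtained from a path $v_1v_2\cdots v_n$ by attaching, for each $1\le i\le n$, two new leaves $u_i$ and $w_i$ adjacent to $v_i$. Then $\tau_s(L_{3n})=2$.
   Context: For vertices $u,v,w$ of a connected graph, $w$ strongly resolves $u,v$ if there is a shortest $u$-$w$ path containing $v$ or a shortest $v$-$w$ path containing $u$. A strong resolving set is a set $W$ such that every pair of vertices is strongly resolved by some vertex of $W$; the strong dimension $\beta_s(H)$ is the minimum size of a strong resolving set of $H$. The threshold strong dimension $\tau_s(G)$ is the minimum of $\beta_s(H)$ over all graphs $H$ having $G$ as a spanning subgraph. -}

module Defs where

open import Data.Nat as ℕ using (ℕ; _<_; _≤_)
open import Data.Fin using (Fin; zero; suc; fromℕ; inject₁; toℕ)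
open import Data.Fin.Patterns using (0F)
open import Data.Product using (Σ; ∃; ∃-syntax; _×_; _,_)
open import Data.Sum using (_⊎_; inj₁; inj₂)
open import Data.Empty using (⊥)
open import Data.List using (List; length)
open import Data.List.Membership.Propositional using (_∈_)
open import Data.List.Relation.Unary.Unique.Propositional using (Unique)
open import Relation.Nullary using (¬_)
open import Relation.Binary.PropositionalEquality using (_≡_; _≢_; refl; sym)
open import Function.Definitions using (Injective)

record Graph (V : Set) : Set₁ where
  field
    Adj    : V → V → Set
    adj-sym : ∀ {x y} → Adj x y → Adj y x
    adj-irrefl : ∀ {x} → ¬ Adj x x
open Graph public

module _ {V : Set} (G : Graph V) where

  record Walk (x y : V) (k : ℕ) : Set where
    field
      vtx   : Fin (ℕ.suc k) → V
      start : vtx zero ≡ x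
      end   : vtx (fromℕ k) ≡ y
      step  : ∀ (i : Fin k) → Adj G (vtx (inject₁ i)) (vtx (suc i))
  open Walk public

  record Path (x y : V) (k : ℕ) : Set where
    field
      walk : Walk x y k
      inj  : Injective _≡_ _≡_ (vtx walk)
  open Path public

  ShortestPath : V → V → ℕ → Set
  ShortestPath x y k = Path x y k × (∀ m → m < k → ¬ Path x y m)

  Contains : ∀ {x y k} → Path x y k → V → Set
  Contains {k = k} p v = ∃[ i ] vtx (walk p) i ≡ v

  StronglyResolves : V → V → V → Set
  StronglyResolves w u v =
      (∃[ k ] Σ (Path u w k) λ p → (∀ m → m < k → ¬ Path u w m) × Contains p v)
    ⊎ (∃[ k ] Σ (Path v w k) λ p → (∀ m → m < k → ¬ Path v w m) × Contains p u)

  StrongResolvingSet : List V → Set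
  StrongResolvingSet W = ∀ u v → u ≢ v → ∃[ w ] (w ∈ W × StronglyResolves w u v)

  IsStrongDim : ℕ → Set
  IsStrongDim b =
      (∃[ W ] (Unique W × StrongResolvingSet W × length W ≡ b))
    × (∀ W → Unique W → StrongResolvingSet W → b ≤ length W)

SpanningSubgraph : {V : Set} → Graph V → Graph V → Set
SpanningSubgraph G H = ∀ {x y} → Adj G x y → Adj H x y

IsThresholdStrongDim : {V : Set} → Graph V → ℕ → Set₁
IsThresholdStrongDim {V} G t =
    (Σ (Graph V) λ H → SpanningSubgraph G H × IsStrongDim H t)
  × (∀ (H : Graph V) → SpanningSubgraph G H → ∀ b → IsStrongDim H b → t ≤ b)

-- The tree L_{3n}. Vertex (i , 0F) is v_{i+1}, (i , 1F) is u_{i+1}, (i , 2F) is w_{i+1}.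
LAdj : (n : ℕ) → Fin n × Fin 3 → Fin n × Fin 3 → Set
LAdj n (i , a) (j , b) =
    (a ≡ 0F × b ≡ 0F × (ℕ.suc (toℕ i) ≡ toℕ j ⊎ ℕ.suc (toℕ j) ≡ toℕ i))
  ⊎ (i ≡ j × ((a ≡ 0F × b ≢ 0F) ⊎ (b ≡ 0F × a ≢ 0F)))

private
  sucn≢n : ∀ (m : ℕ) → ℕ.suc m ≢ m
  sucn≢n ℕ.zero ()
  sucn≢n (ℕ.suc m) e = sucn≢n m (Data.Nat.Properties.suc-injective e)
    where import Data.Nat.Properties

  LAdj-sym : ∀ n {x y} → LAdj n x y → LAdj n y x
  LAdj-sym n (inj₁ (a , b , inj₁ e)) = inj₁ (b , a , inj₂ e)
  LAdj-sym n (inj₁ (a , b , inj₂ e)) = inj₁ (b , a , inj₁ e)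
  LAdj-sym n (inj₂ (e , inj₁ (a , b))) = inj₂ (sym e , inj₂ (a , b))
  LAdj-sym n (inj₂ (e , inj₂ (a , b))) = inj₂ (sym e , inj₁ (a , b))

  LAdj-irrefl : ∀ n {x} → ¬ LAdj n x x
  LAdj-irrefl n {i , a} (inj₁ (_ , _ , inj₁ e)) = sucn≢n (toℕ i) e
  LAdj-irrefl n {i , a} (inj₁ (_ , _ , inj₂ e)) = sucn≢n (toℕ i) e
  LAdj-irrefl n (inj₂ (_ , inj₁ (a , b))) = b a
  LAdj-irrefl n (inj₂ (_ , inj₂ (a , b))) = b a

L3 : (n : ℕ) → Graph (Fin n × Fin 3)
L3 n = record { Adj = LAdj n ; adj-sym = LAdj-sym n ; adj-irrefl = LAdj-irrefl n }

module Submission where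

-- If a single vertex w strongly resolved every pair of a graph,
-- no two distinct vertices could lie at the same distance from w: the one on
-- a shortest path of the other would be strictly closer to w.  A vertex c
-- with three distinct neighbours gives four vertices whose distances to w all
-- lie within one of d(c, w), so two of them coincide.  In L_{3n}, hence in
-- every graph H having L_{3n} as a spanning subgraph, v₁ has the three
-- neighbours u₁, w₁, v₂; so every strong resolving set of H has size ≥ 2.
--
-- Adding the edges u_i u_{i+1} and w_i w_{i+1} turns L_{3n}
-- into the 3 × n grid, with rows ordered u, v, w.  The potential
-- "column + height" changes by at most one along each edge, so a path on
-- which it drops by one per step is a shortest path.  Hence the corner
-- (first column, row u) strongly resolves every pair that is comparable in
-- the coordinatewise order, and by the left–right reflection of the grid the
-- other end of row u resolves every remaining pair.

open import Defs
open import Data.Nat using (ℕ; _≤_)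
open import Data.Nat using (zero; suc; _+_; _∸_; _<_; z≤n; s≤s)
open import Data.Nat.Properties
open import Data.Nat.Induction using (<-rec)
open import Data.Fin using (Fin; zero; suc; fromℕ<; inject₁; toℕ; opposite)
open import Data.Fin.Properties
  using (toℕ-injective; toℕ-fromℕ<; fromℕ<-toℕ; toℕ<n; any?; opposite-prop; opposite-involutive)
  renaming (suc-injective to Fin-suc-injective; _≟_ to _≟ᶠ_)
open import Data.Fin.Patterns using (0F; 1F; 2F)
open import Data.Product using (Σ; ∃-syntax; _×_; _,_; proj₁; proj₂)
open import Data.Product.Properties using (≡-dec)
open import Data.Sum using (_⊎_; inj₁; inj₂; swap)
open import Data.Empty using (⊥; ⊥-elim)
open import Data.List using ([]; _∷_; length)
open import Data.List.Relation.Unary.Any using (here; there)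
import Data.List.Relation.Unary.All as All
import Data.List.Relation.Unary.AllPairs as AllPairs
open import Data.List.Relation.Unary.Unique.Propositional using (Unique)
open import Function using (_∘_)
open import Function.Definitions using (Injective)
open import Relation.Nullary using (¬_; yes; no)
open import Relation.Binary.Definitions using (DecidableEquality; tri<; tri≈; tri>)
open import Relation.Binary.PropositionalEquality

module GraphPaths {V : Set} (G : Graph V) where

  adjacent-distinct : ∀ {x y} → Adj G x y → x ≢ y
  adjacent-distinct xy refl = adj-irrefl G xy

  walkNil : ∀ {x} → Walk G x x 0
  walkNil {x} = record { vtx = λ _ → x ; start = refl ; end = refl ; step = λ () }

  walkCons : ∀ {x y z k} → Adj G x y → Walk G y z k → Walk G x z (suc k)
  walkCons {x} {k = k} xy p = record { vtx = vertices ; start = refl ; end = end p ; step = steps }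
    where
      vertices : Fin (suc (suc k)) → V
      vertices zero = x
      vertices (suc j) = vtx p j
      steps : ∀ j → Adj G (vertices (inject₁ j)) (vertices (suc j))
      steps zero = subst (Adj G x) (sym (start p)) xy
      steps (suc j) = step p j

  walkTail : ∀ {x y k} (p : Walk G x y (suc k)) → Walk G (vtx p (suc zero)) y k
  walkTail p = record
    { vtx = λ j → vtx p (suc j) ; start = refl ; end = end p ; step = λ j → step p (suc j) }

  pathTail : ∀ {x y k} (p : Path G x y (suc k)) → Path G (vtx (walk p) (suc zero)) y k
  pathTail p = record { walk = walkTail (walk p) ; inj = Fin-suc-injective ∘ inj p }

  suffix : ∀ {x y k} (p : Path G x y k) (i : Fin (suc k)) → Path G (vtx (walk p) i) y (k ∸ toℕ i)
  suffix {y = y} {k} p zero = subst (λ u → Path G u y k) (sym (start (walk p))) p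
  suffix {k = suc k} p (suc i) = suffix (pathTail p) i

  shortcut : ∀ {x y z k} (p : Path G x z k) → Contains G p y → y ≢ x →
             ∃[ m ] (m < k × Path G y z m)
  shortcut p (zero , e) y≢x = ⊥-elim (y≢x (trans (sym e) (start (walk p))))
  shortcut {z = z} {suc k} p (suc i , e) _ =
    k ∸ toℕ i , s≤s (m∸n≤m k (toℕ i))
              , subst (λ u → Path G u z (k ∸ toℕ i)) e (suffix p (suc i))

  shortestExists : ∀ {x z m} → Path G x z m → ¬ ¬ (∃[ k ] ShortestPath G x z k)
  shortestExists {x} {z} {m} p noShortest = noPath m p
    where
      noPath : ∀ k → ¬ Path G x z k
      noPath = <-rec _ λ k shorter q → noShortest (k , q , λ j j<k → shorter j<k)

  module _ (_≟_ : DecidableEquality V) where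

    -- Prepending an edge x–y to a path from y gives a path from x at most one
    -- edge longer (cutting the path short if it already visits x).
    prepend : ∀ {x y z m} → Adj G x y → Path G y z m → ∃[ m' ] (m' ≤ suc m × Path G x z m')
    prepend {x} {z = z} {m} xy p with any? (λ i → vtx (walk p) i ≟ x)
    ... | yes (i , e) = m ∸ toℕ i , ≤-trans (m∸n≤m m (toℕ i)) (n≤1+n m)
                      , subst (λ u → Path G u z (m ∸ toℕ i)) e (suffix p i)
    ... | no x∉p = suc m , ≤-refl , record { walk = walkCons xy (walk p) ; inj = injective }
      where
        injective : Injective _≡_ _≡_ (vtx (walkCons xy (walk p)))
        injective {zero} {zero} _ = refl
        injective {zero} {suc j} e = ⊥-elim (x∉p (j , sym e))
        injective {suc i} {zero} e = ⊥-elim (x∉p (i , e))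
        injective {suc i} {suc j} e = cong suc (inj p e)

    adjacentDistance : ∀ {x y z dx dy} → Adj G x y →
                       ShortestPath G x z dx → ShortestPath G y z dy → dx ≤ suc dy
    adjacentDistance xy (_ , xMin) (py , _) with prepend xy py
    ... | m , m≤1+dy , px = ≤-trans (≮⇒≥ λ m<dx → xMin m m<dx px) m≤1+dy

  ShortestThrough : V → V → V → Set
  ShortestThrough u w v =
    ∃[ k ] Σ (Path G u w k) λ p → (∀ m → m < k → ¬ Path G u w m) × Contains G p v

  -- A potential f that changes by at most one along each edge bounds path
  -- lengths from below; paths on which f drops by one per step are shortest.
  module Potential (f : V → ℕ) (lipschitz : ∀ {a b} → Adj G a b → f a ≤ suc (f b)) where

    walkBound : ∀ {x z} k → Walk G x z k → f x ≤ f z + k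
    walkBound {x} {z} zero p =
      ≤-reflexive (trans (cong f (trans (sym (start p)) (end p))) (sym (+-identityʳ (f z))))
    walkBound {x} {z} (suc k) p = begin
      f x                          ≡⟨ cong f (start p) ⟨
      f (vtx p zero)               ≤⟨ lipschitz (step p zero) ⟩
      suc (f (vtx p (suc zero)))   ≤⟨ s≤s (walkBound k (walkTail p)) ⟩
      suc (f z + k)                ≡⟨ +-suc (f z) k ⟨
      f z + suc k                  ∎
      where open ≤-Reasoning hiding (start)

    data Descent : V → V → ℕ → Set where
      done : ∀ {x} → Descent x x 0
      down : ∀ {x y z k} → Adj G x y → f x ≡ suc (f y) → Descent y z k → Descent x z (suc k)

    _++ᵈ_ : ∀ {x y z k l} → Descent x y k → Descent y z l → Descent x z (k + l)
    done ++ᵈ e = e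
    down xy fx d ++ᵈ e = down xy fx (d ++ᵈ e)

    descentWalk : ∀ {x z k} → Descent x z k → Walk G x z k
    descentWalk done = walkNil
    descentWalk (down xy _ d) = walkCons xy (descentWalk d)

    descentHeight : ∀ {x z k} (d : Descent x z k) (i : Fin (suc k)) →
                    f (vtx (descentWalk d) i) + toℕ i ≡ f x
    descentHeight done zero = +-identityʳ _
    descentHeight (down _ _ d) zero = +-identityʳ _
    descentHeight (down _ fx d) (suc i) =
      trans (+-suc _ (toℕ i)) (trans (cong suc (descentHeight d i)) (sym fx))

    descentLength : ∀ {x z k} → Descent x z k → f x ≡ k + f z
    descentLength done = refl
    descentLength (down _ fx d) = trans fx (cong suc (descentLength d))

    -- A descent visits distinct vertices, since their potentials differ.
    descentPath : ∀ {x z k} → Descent x z k → Path G x z k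
    descentPath {x} d = record { walk = descentWalk d ; inj = injective }
      where
        v = vtx (descentWalk d)
        injective : Injective _≡_ _≡_ v
        injective {i} {j} e = toℕ-injective (+-cancelˡ-≡ (f (v i)) (toℕ i) (toℕ j) (begin
          f (v i) + toℕ i  ≡⟨ descentHeight d i ⟩
          f x              ≡⟨ descentHeight d j ⟨
          f (v j) + toℕ j  ≡⟨ cong (λ u → f u + toℕ j) e ⟨
          f (v i) + toℕ j  ∎))
          where open ≡-Reasoning

    descentShortest : ∀ {x z k} → Descent x z k → ∀ m → m < k → ¬ Path G x z m
    descentShortest {x} {z} {k} d m m<k q = <-irrefl (descentLength d) (begin-strict
      f x      ≤⟨ walkBound m (walk q) ⟩
      f z + m  ≡⟨ +-comm (f z) m ⟩
      m + f z  <⟨ +-monoˡ-< (f z) m<k ⟩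
      k + f z  ∎)
      where open ≤-Reasoning hiding (start)

    junction : ∀ {x y z k l} (d : Descent x y k) (e : Descent y z l) →
               Contains G (descentPath (d ++ᵈ e)) y
    junction done e = zero , start (descentWalk e)
    junction (down _ _ d) e with junction d e
    ... | i , y∈p = suc i , y∈p

    descentResolves : ∀ {u v w k l} → Descent u v k → Descent v w l → StronglyResolves G w u v
    descentResolves d e =
      inj₁ (_ , descentPath (d ++ᵈ e) , descentShortest (d ++ᵈ e) , junction d e)

  module Involution (σ : V → V) (σ-involutive : ∀ x → σ (σ x) ≡ x)
                    (σ-adj : ∀ {x y} → Adj G x y → Adj G (σ x) (σ y)) where

    mapPath : ∀ {x y x' y' k} → Path G x y k → σ x ≡ x' → σ y ≡ y' → Path G x' y' k
    mapPath p σx≡x' σy≡y' = record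
      { walk = record { vtx = σ ∘ vtx (walk p) ; start = trans (cong σ (start (walk p))) σx≡x'
                      ; end = trans (cong σ (end (walk p))) σy≡y' ; step = σ-adj ∘ step (walk p) }
      ; inj = λ e → inj p (trans (sym (σ-involutive _)) (trans (cong σ e) (σ-involutive _))) }

    -- σ carries shortest paths to shortest paths, because σ is its own inverse.
    mapThrough : ∀ {u w v} → ShortestThrough (σ u) w (σ v) → ShortestThrough u (σ w) v
    mapThrough {u} {w} {v} (k , p , pMin , i , e) =
        k , mapPath p (σ-involutive u) refl
      , (λ m m<k q → pMin m m<k (mapPath q refl (σ-involutive w)))
      , i , trans (cong σ e) (σ-involutive v)

    σ-resolves : ∀ {w u v} → StronglyResolves G w (σ u) (σ v) → StronglyResolves G (σ w) u v
    σ-resolves (inj₁ r) = inj₁ (mapThrough r)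
    σ-resolves (inj₂ r) = inj₂ (mapThrough r)

Near : ℕ → ℕ → Set
Near x c = x ≡ c ⊎ x ≡ suc c ⊎ suc x ≡ c

withinOne : ∀ {x c} → x ≤ suc c → c ≤ suc x → Near x c
withinOne {x} {c} x≤1+c c≤1+x with <-cmp x c
... | tri< x<c _ _ = inj₂ (inj₂ (≤-antisym x<c c≤1+x))
... | tri≈ _ x≡c _ = inj₁ x≡c
... | tri> _ _ c<x = inj₂ (inj₁ (≤-antisym x≤1+c c<x))

module SingleResolver {V : Set} (G : Graph V) (_≟_ : DecidableEquality V) (w : V) where
  open GraphPaths G

  notThrough : ∀ {x y d d'} → ShortestPath G x w d → ShortestPath G y w d' → d ≡ d' → y ≢ x →
               ¬ ShortestThrough x w y
  notThrough (px , _) (_ , yMin) refl y≢x (k , p , pMin , y∈p) with shortcut p y∈p y≢x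
  ... | m , m<k , q = yMin m (<-≤-trans m<k (≮⇒≥ λ d<k → pMin _ d<k px)) q

  equidistantUnresolved : ∀ {x y d d'} → ShortestPath G x w d → ShortestPath G y w d' → d ≡ d' →
                          x ≢ y → ¬ StronglyResolves G w x y
  equidistantUnresolved sx sy d≡d' x≢y (inj₁ r) = notThrough sx sy d≡d' (x≢y ∘ sym) r
  equidistantUnresolved sx sy d≡d' x≢y (inj₂ r) = notThrough sy sx (sym d≡d') x≢y r

  neighbourDistance : ∀ {c a dc} → Adj G c a → ShortestPath G c w dc →
                      ¬ ¬ (∃[ d ] (ShortestPath G a w d × Near d dc))
  neighbourDistance ca sc noNear =
    shortestExists (proj₂ (proj₂ (prepend _≟_ (adj-sym G ca) (proj₁ sc)))) λ (d , sa) →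
    noNear (d , sa , withinOne (adjacentDistance _≟_ (adj-sym G ca) sa sc)
                               (adjacentDistance _≟_ ca sc sa))

  -- w does not strongly resolve all pairs among a vertex and three distinct
  -- neighbours: by pigeonhole two of the four distances coincide.
  starUnresolved : ∀ {c a₁ a₂ a₃} → Adj G c a₁ → Adj G c a₂ → Adj G c a₃ →
                   a₁ ≢ a₂ → a₁ ≢ a₃ → a₂ ≢ a₃ →
                   ¬ (∀ u v → u ≢ v → StronglyResolves G w u v)
  starUnresolved {c} {a₁} {a₂} {a₃} ca₁ ca₂ ca₃ a₁≢a₂ a₁≢a₃ a₂≢a₃ resolves =
    shortestFromC λ (dc , sc) →
    neighbourDistance ca₁ sc λ (d₁ , s₁ , n₁) →
    neighbourDistance ca₂ sc λ (d₂ , s₂ , n₂) →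
    neighbourDistance ca₃ sc λ (d₃ , s₃ , n₃) →
    twoEqual sc s₁ s₂ s₃ n₁ n₂ n₃
    where
      clash : ∀ {x y dx dy} → ShortestPath G x w dx → ShortestPath G y w dy → dx ≡ dy → x ≢ y → ⊥
      clash sx sy dx≡dy x≢y = equidistantUnresolved sx sy dx≡dy x≢y (resolves _ _ x≢y)

      -- Some path joins c to w, since w resolves the pair c, a₁.
      shortestFromC : ¬ ¬ (∃[ k ] ShortestPath G c w k)
      shortestFromC with resolves c a₁ (adjacent-distinct ca₁)
      ... | inj₁ (_ , p , _) = shortestExists p
      ... | inj₂ (_ , p , _) = shortestExists (proj₂ (proj₂ (prepend _≟_ ca₁ p)))

      twoEqual : ∀ {dc d₁ d₂ d₃} → ShortestPath G c w dc → ShortestPath G a₁ w d₁ →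
                 ShortestPath G a₂ w d₂ → ShortestPath G a₃ w d₃ →
                 Near d₁ dc → Near d₂ dc → Near d₃ dc → ⊥
      twoEqual sc s₁ s₂ s₃ (inj₁ e) _ _ = clash s₁ sc e (adjacent-distinct ca₁ ∘ sym)
      twoEqual sc s₁ s₂ s₃ _ (inj₁ e) _ = clash s₂ sc e (adjacent-distinct ca₂ ∘ sym)
      twoEqual sc s₁ s₂ s₃ _ _ (inj₁ e) = clash s₃ sc e (adjacent-distinct ca₃ ∘ sym)
      twoEqual sc s₁ s₂ s₃ (inj₂ (inj₁ e₁)) (inj₂ (inj₁ e₂)) _ =
        clash s₁ s₂ (trans e₁ (sym e₂)) a₁≢a₂
      twoEqual sc s₁ s₂ s₃ (inj₂ (inj₂ e₁)) (inj₂ (inj₂ e₂)) _ =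
        clash s₁ s₂ (suc-injective (trans e₁ (sym e₂))) a₁≢a₂
      twoEqual sc s₁ s₂ s₃ (inj₂ (inj₁ e₁)) _ (inj₂ (inj₁ e₃)) =
        clash s₁ s₃ (trans e₁ (sym e₃)) a₁≢a₃
      twoEqual sc s₁ s₂ s₃ (inj₂ (inj₂ e₁)) _ (inj₂ (inj₂ e₃)) =
        clash s₁ s₃ (suc-injective (trans e₁ (sym e₃))) a₁≢a₃
      twoEqual sc s₁ s₂ s₃ _ (inj₂ (inj₁ e₂)) (inj₂ (inj₁ e₃)) =
        clash s₂ s₃ (trans e₂ (sym e₃)) a₂≢a₃
      twoEqual sc s₁ s₂ s₃ _ (inj₂ (inj₂ e₂)) (inj₂ (inj₂ e₃)) =
        clash s₂ s₃ (suc-injective (trans e₂ (sym e₃))) a₂≢a₃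

starLowerBound : ∀ {V} (G : Graph V) → DecidableEquality V → ∀ {c a₁ a₂ a₃} →
                 Adj G c a₁ → Adj G c a₂ → Adj G c a₃ → a₁ ≢ a₂ → a₁ ≢ a₃ → a₂ ≢ a₃ →
                 ∀ W → StrongResolvingSet G W → 2 ≤ length W
starLowerBound G _ ca₁ _ _ _ _ _ [] resolving
  with resolving _ _ (GraphPaths.adjacent-distinct G ca₁)
... | _ , () , _
starLowerBound G _≟_ ca₁ ca₂ ca₃ a₁≢a₂ a₁≢a₃ a₂≢a₃ (w ∷ []) resolving =
  ⊥-elim (SingleResolver.starUnresolved G _≟_ w ca₁ ca₂ ca₃ a₁≢a₂ a₁≢a₃ a₂≢a₃ byW)
  where
    byW : ∀ u v → u ≢ v → StronglyResolves G w u v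
    byW u v u≢v with resolving u v u≢v
    ... | _ , here refl , r = r
starLowerBound G _ _ _ _ _ _ _ (_ ∷ _ ∷ _) _ = s≤s (s≤s z≤n)

lowerBound-L3 : ∀ m (H : Graph (Fin (suc (suc m)) × Fin 3)) → SpanningSubgraph (L3 (suc (suc m))) H →
                ∀ W → StrongResolvingSet H W → 2 ≤ length W
lowerBound-L3 m H L3⊆H = starLowerBound H (≡-dec _≟ᶠ_ _≟ᶠ_)
  (L3⊆H v₁u₁) (L3⊆H v₁w₁) (L3⊆H v₁v₂) (λ ()) (λ ()) (λ ())
  where
    v₁u₁ : LAdj (suc (suc m)) (zero , 0F) (zero , 1F)
    v₁u₁ = inj₂ (refl , inj₁ (refl , λ ()))
    v₁w₁ : LAdj (suc (suc m)) (zero , 0F) (zero , 2F)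
    v₁w₁ = inj₂ (refl , inj₁ (refl , λ ()))
    v₁v₂ : LAdj (suc (suc m)) (zero , 0F) (suc zero , 0F)
    v₁v₂ = inj₁ (refl , refl , inj₁ refl)

-- The 3 × (m + 1) grid: L_{3(m+1)} together with the edges u_i u_{i+1} and
-- w_i w_{i+1}.  Rows are ordered u, v, w.
module Grid (m : ℕ) where

  n : ℕ
  n = suc m

  Vertex : Set
  Vertex = Fin n × Fin 3

  Neighbouring : Fin n → Fin n → Set
  Neighbouring i j = suc (toℕ i) ≡ toℕ j ⊎ suc (toℕ j) ≡ toℕ i

  ColumnEdge : Fin 3 → Fin 3 → Set
  ColumnEdge a b = (a ≡ 0F × b ≢ 0F) ⊎ (b ≡ 0F × a ≢ 0F)

  GridAdj : Vertex → Vertex → Set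
  GridAdj (i , a) (j , b) = (a ≡ b × Neighbouring i j) ⊎ (i ≡ j × ColumnEdge a b)

  gridAdj-sym : ∀ {x y} → GridAdj x y → GridAdj y x
  gridAdj-sym (inj₁ (a≡b , ij)) = inj₁ (sym a≡b , swap ij)
  gridAdj-sym (inj₂ (i≡j , ab)) = inj₂ (sym i≡j , swap ab)

  gridAdj-irrefl : ∀ {x} → ¬ GridAdj x x
  gridAdj-irrefl (inj₁ (_ , inj₁ e)) = 1+n≢n e
  gridAdj-irrefl (inj₁ (_ , inj₂ e)) = 1+n≢n e
  gridAdj-irrefl (inj₂ (_ , inj₁ (a≡0 , a≢0))) = a≢0 a≡0
  gridAdj-irrefl (inj₂ (_ , inj₂ (a≡0 , a≢0))) = a≢0 a≡0

  grid : Graph Vertex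
  grid = record { Adj = GridAdj ; adj-sym = gridAdj-sym ; adj-irrefl = gridAdj-irrefl }

  spanning : SpanningSubgraph (L3 n) grid
  spanning (inj₁ (a≡0 , b≡0 , ij)) = inj₁ (trans a≡0 (sym b≡0) , ij)
  spanning (inj₂ column) = inj₂ column

  height : Fin 3 → ℕ
  height 0F = 1
  height 1F = 0
  height 2F = 2

  height≤2 : ∀ a → height a ≤ 2
  height≤2 0F = s≤s z≤n
  height≤2 1F = z≤n
  height≤2 2F = ≤-refl

  -- Column plus height: the distance to the corner (first column, row u).
  potential : Vertex → ℕ
  potential (i , a) = toℕ i + height a

  column-lipschitz : ∀ {i j} → Neighbouring i j → toℕ i ≤ suc (toℕ j)
  column-lipschitz {i} {j} (inj₁ e) = ≤-trans (n≤1+n (toℕ i)) (≤-trans (≤-reflexive e) (n≤1+n (toℕ j)))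
  column-lipschitz (inj₂ e) = ≤-reflexive (sym e)

  height-lipschitz : ∀ {a b} → ColumnEdge a b → height a ≤ suc (height b)
  height-lipschitz (inj₁ (refl , _)) = s≤s z≤n
  height-lipschitz {a} (inj₂ (refl , _)) = height≤2 a

  potential-lipschitz : ∀ {x y} → GridAdj x y → potential x ≤ suc (potential y)
  potential-lipschitz {i , a} (inj₁ (refl , ij)) = +-monoˡ-≤ (height a) (column-lipschitz ij)
  potential-lipschitz {i , a} {_ , b} (inj₂ (refl , ab)) =
    ≤-trans (+-monoʳ-≤ (toℕ i) (height-lipschitz ab)) (≤-reflexive (+-suc (toℕ i) (height b)))

  open GraphPaths grid
  open Potential potential potential-lipschitz

  vu : ∀ {i} → GridAdj (i , 0F) (i , 1F)
  vu = inj₂ (refl , inj₁ (refl , λ ()))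

  wv : ∀ {i} → GridAdj (i , 2F) (i , 0F)
  wv = inj₂ (refl , inj₂ (refl , λ ()))

  columnDescent : ∀ i a b → height b ≤ height a → ∃[ k ] Descent (i , a) (i , b) k
  columnDescent i 0F 0F _ = _ , done
  columnDescent i 0F 1F _ = _ , down vu (+-suc (toℕ i) 0) done
  columnDescent i 0F 2F (s≤s ())
  columnDescent i 1F 0F ()
  columnDescent i 1F 1F _ = _ , done
  columnDescent i 1F 2F ()
  columnDescent i 2F 0F _ = _ , down wv (+-suc (toℕ i) 1) done
  columnDescent i 2F 1F _ = _ , down wv (+-suc (toℕ i) 1) (down vu (+-suc (toℕ i) 0) done)
  columnDescent i 2F 2F _ = _ , done

  rowDescentFrom : ∀ a (k : Fin n) j (j<n : j < n) → toℕ k ≤ j →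
                   ∃[ l ] Descent (fromℕ< j<n , a) (k , a) l
  rowDescentFrom a k j j<n k≤j with m≤n⇒m<n∨m≡n k≤j
  ... | inj₂ k≡j = 0 , subst (λ i → Descent (i , a) (k , a) 0) k≡fromℕ<j done
    where
      k≡fromℕ<j : k ≡ fromℕ< j<n
      k≡fromℕ<j = toℕ-injective (trans k≡j (sym (toℕ-fromℕ< j<n)))
  rowDescentFrom a k (suc j) j+1<n _ | inj₁ (s≤s k≤j) =
    _ , down (inj₁ (refl , inj₂ j~j+1)) (cong (_+ height a) (sym j~j+1))
             (proj₂ (rowDescentFrom a k j j<n k≤j))
    where
      j<n : j < n
      j<n = ≤-trans (n≤1+n (suc j)) j+1<n
      j~j+1 : suc (toℕ (fromℕ< j<n)) ≡ toℕ (fromℕ< j+1<n)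
      j~j+1 = trans (cong suc (toℕ-fromℕ< j<n)) (sym (toℕ-fromℕ< j+1<n))

  rowDescent : ∀ a (j k : Fin n) → toℕ k ≤ toℕ j → ∃[ l ] Descent (j , a) (k , a) l
  rowDescent a j k k≤j = subst (λ i → ∃[ l ] Descent (i , a) (k , a) l) (fromℕ<-toℕ j (toℕ<n j))
                           (rowDescentFrom a k (toℕ j) (toℕ<n j) k≤j)

  _≼_ : Vertex → Vertex → Set
  (i , a) ≼ (j , b) = toℕ i ≤ toℕ j × height a ≤ height b

  corner : Vertex
  corner = zero , 1F

  -- The corner (first column, row u) strongly resolves every comparable pair
  -- q ≼ p: descend from p to q, then from q to the corner.
  cornerResolves : ∀ p q → q ≼ p → StronglyResolves grid corner p q
  cornerResolves (i , a) (j , b) (j≤i , b≤a) = descentResolves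
    (proj₂ (columnDescent i a b b≤a) ++ᵈ proj₂ (rowDescent b i j j≤i))
    (proj₂ (columnDescent j b 1F z≤n) ++ᵈ proj₂ (rowDescent 1F j zero z≤n))

  reflect : Vertex → Vertex
  reflect (i , a) = opposite i , a

  reflect-involutive : ∀ x → reflect (reflect x) ≡ x
  reflect-involutive (i , a) = cong (_, a) (opposite-involutive i)

  opposite-step : ∀ {i j : Fin n} → suc (toℕ i) ≡ toℕ j → suc (toℕ (opposite j)) ≡ toℕ (opposite i)
  opposite-step {i} {j} i+1≡j = begin
    suc (toℕ (opposite j))  ≡⟨ cong suc (opposite-prop j) ⟩
    suc (n ∸ suc (toℕ j))   ≡⟨ +-∸-assoc 1 (toℕ<n j) ⟨
    n ∸ toℕ j               ≡⟨ cong (n ∸_) i+1≡j ⟨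
    n ∸ suc (toℕ i)         ≡⟨ opposite-prop i ⟨
    toℕ (opposite i)        ∎
    where open ≡-Reasoning

  reflect-adj : ∀ {x y} → GridAdj x y → GridAdj (reflect x) (reflect y)
  reflect-adj (inj₁ (a≡b , inj₁ i+1≡j)) = inj₁ (a≡b , inj₂ (opposite-step i+1≡j))
  reflect-adj (inj₁ (a≡b , inj₂ j+1≡i)) = inj₁ (a≡b , inj₁ (opposite-step j+1≡i))
  reflect-adj (inj₂ (i≡j , ab)) = inj₂ (cong opposite i≡j , ab)

  opposite-antitone : ∀ {i j : Fin n} → toℕ i ≤ toℕ j → toℕ (opposite j) ≤ toℕ (opposite i)
  opposite-antitone {i} {j} i≤j =
    subst₂ _≤_ (sym (opposite-prop j)) (sym (opposite-prop i)) (∸-monoʳ-≤ n (s≤s i≤j))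

  open Involution reflect reflect-involutive reflect-adj

  -- The two ends of row u form a strong resolving set: a pair that is not
  -- comparable for the corner becomes comparable after reflection.
  cornersResolve : StrongResolvingSet grid (corner ∷ reflect corner ∷ [])
  cornersResolve (i , a) (j , b) _ with ≤-total (toℕ j) (toℕ i) | ≤-total (height b) (height a)
  ... | inj₁ j≤i | inj₁ b≤a = corner , here refl , cornerResolves (i , a) (j , b) (j≤i , b≤a)
  ... | inj₂ i≤j | inj₂ a≤b = corner , here refl , swap (cornerResolves (j , b) (i , a) (i≤j , a≤b))
  ... | inj₁ j≤i | inj₂ a≤b = reflect corner , there (here refl) ,
        σ-resolves (swap (cornerResolves (opposite j , b) (opposite i , a)
                                         (opposite-antitone j≤i , a≤b)))
  ... | inj₂ i≤j | inj₁ b≤a = reflect corner , there (here refl) ,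
        σ-resolves (cornerResolves (opposite i , a) (opposite j , b) (opposite-antitone i≤j , b≤a))

mainTheorem11 : ∀ (n : ℕ) → 2 ≤ n → IsThresholdStrongDim (L3 n) 2
mainTheorem11 (suc (suc m)) _ =
    (grid , spanning , ((corner ∷ reflect corner ∷ []) , cornersDistinct , cornersResolve , refl)
                     , λ W _ → lowerBound-L3 m grid spanning W)
  , λ H L3⊆H b ((W , _ , W-resolves , |W|≡b) , _) →
      subst (2 ≤_) |W|≡b (lowerBound-L3 m H L3⊆H W W-resolves)
  where
    open Grid (suc m)
    cornersDistinct : Unique (corner ∷ reflect corner ∷ [])
    cornersDistinct = ((λ ()) All.∷ All.[]) AllPairs.∷ (All.[] AllPairs.∷ AllPairs.[])
mainTheorem11 (suc zero) (s≤s ())
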